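{- Let $m\ge1$ and $p\in S_m$. Then the following are equivalent: (i) for every $n\ge2$ there exist only finitely many $\omega\in\widetilde{S}_n$ that avoid $p$; (ii) $p$ avoids the pattern $321$.
   Context: For $n\ge1$, the affine symmetric group $\widetilde{S}_n$ is the set of all bijections $\omega:\mathbb{Z}\to\mathbb{Z}$ with $\omega(i+n)=\omega(i)+n$ for all $i\in\mathbb{Z}$ and $\sum_{i=1}^n\omega(i)=\binom{n+1}{2}$; write $\omega_i=\omega(i)$, so $\omega$ is viewed as the bi-infinite sequence $\cdots\omega_{ -1}\omega_0\omega_1\cdots\omega_n\omega_{n+1}\cdots$. For $p\in S_k$, $\omega$ contains $p$ if there are integers $i_1<\cdots<i_k$ (any integers, not necessarily in $[1,n]$) such that $\omega_{i_1}\cdots\omega_{i_k}$ has the same relative order as $p_1\cdots p_k$; otherwise $\omega$ avoids $p$. Similarly a permutation $p\in S_m$ contains/avoids $321$ in the usual sense (there exist $a<b<c$ with $p_a>p_b>p_c$). -}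

module Defs where

open import Data.Nat as ℕ using (ℕ; zero; suc)
open import Data.Nat.Combinatorics using (_C_)
open import Data.Integer as ℤ using (ℤ; +_)
open import Data.Fin as Fin using (Fin)
open import Data.Fin.Permutation using (Permutation′; _⟨$⟩ʳ_)
open import Data.Product using (Σ; ∃; _×_; _,_)
open import Data.List using (List)
open import Data.List.Relation.Unary.Any using (Any)
open import Function.Definitions using (Bijective)
open import Relation.Binary.PropositionalEquality using (_≡_)
open import Relation.Nullary using (¬_)

windowSum : (ℤ → ℤ) → ℕ → ℤ
windowSum ω zero    = + 0
windowSum ω (suc k) = windowSum ω k ℤ.+ ω (+ suc k)

record IsAffinePerm (n : ℕ) (ω : ℤ → ℤ) : Set where
  field
    bijective : Bijective _≡_ _≡_ ω
    periodic  : ∀ i → ω (i ℤ.+ + n) ≡ ω i ℤ.+ + n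
    sumWindow : windowSum ω n ≡ + (suc n C 2)

AffContains : ∀ {m} → (ℤ → ℤ) → Permutation′ m → Set
AffContains {m} ω p =
  Σ (Fin m → ℤ) λ idx →
    (∀ a b → a Fin.< b → idx a ℤ.< idx b) ×
    (∀ a b → ((p ⟨$⟩ʳ a) Fin.< (p ⟨$⟩ʳ b) → ω (idx a) ℤ.< ω (idx b))
           × (ω (idx a) ℤ.< ω (idx b) → (p ⟨$⟩ʳ a) Fin.< (p ⟨$⟩ʳ b)))

AffAvoids : ∀ {m} → (ℤ → ℤ) → Permutation′ m → Set
AffAvoids ω p = ¬ AffContains ω p

Contains321 : ∀ {m} → Permutation′ m → Set
Contains321 {m} p = Σ (Fin m) λ a → Σ (Fin m) λ b → Σ (Fin m) λ c →
  a Fin.< b × b Fin.< c ×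
  (p ⟨$⟩ʳ b) Fin.< (p ⟨$⟩ʳ a) × (p ⟨$⟩ʳ c) Fin.< (p ⟨$⟩ʳ b)

Avoids321 : ∀ {m} → Permutation′ m → Set
Avoids321 p = ¬ Contains321 p

-- Finitely many elements of S̃_n avoid p: there is a finite list of maps
-- ℤ → ℤ such that every p-avoiding ω ∈ S̃_n agrees pointwise with one of them.
FinitelyManyAvoiders : ∀ {m} → ℕ → Permutation′ m → Set
FinitelyManyAvoiders n p =
  Σ (List (ℤ → ℤ)) λ L →
    ∀ ω → IsAffinePerm n ω → AffAvoids ω p →
      Any (λ f → ∀ i → ω i ≡ f i) L

module Submission where

open import Defs
open import Data.Nat using (ℕ; _≤_; s≤s; z≤n)
open import Data.Nat.Properties using (≤-refl; ≤-trans)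
open import Data.Fin.Permutation using (Permutation′)
open import Function.Bundles using (_⇔_; mk⇔)

-- (⇐) Let p avoid 321 and let ω ∈ S̃_n avoid p.  The key fact
-- (Patterns.LargeDescent) is that a descent ω i ≥ ω (i + e) + 2·3^m·n with
-- 0 < e < n already forces p: the left-to-right maxima of p are placed on
-- translates i + φ k·n of position i and the remaining entries, which
-- increase because p avoids 321, on translates of i + e, with levels φ k
-- constructed in Levels.  Hence (Displacement) the n-periodic displacement
-- ω z − z, whose window sum vanishes, is bounded by K = 2·3^m·n + n, and ω
-- is one of the finitely many maps z ↦ z + d (z mod n) with |d| ≤ K
-- (Finiteness).
--
-- (⇒) If p contains 321, the maps of S̃_2 shifting even integers by −2c and
-- odd ones by +2c are unions of two increasing sequences, so they avoid p,
-- and they are pairwise distinct (Infinitude).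

-- Levels for placing a 321-avoiding sequence on two parallel tracks.
module Levels where

  open import Data.Nat
  open import Data.Nat.Properties
  open import Data.Nat.Induction using (<-rec)
  open import Function using (_∘_)
  open import Data.Nat.Tactic.RingSolver using (solve-∀)
  open import Data.Product using (∃; _×_; _,_)
  open import Data.Sum using (inj₁; inj₂; [_,_]′)
  open import Data.Empty using (⊥; ⊥-elim)
  open import Relation.Nullary using (¬_; Dec; yes; no; _×-dec_; ¬?)
  open import Relation.Nullary.Decidable using (toSum)
  open import Relation.Binary.PropositionalEquality
  open import Relation.Binary.Definitions using (tri<; tri≈; tri>)

  maxBelow : ℕ → (ℕ → ℕ) → ℕ
  maxBelow zero    g = 0
  maxBelow (suc k) g = maxBelow k g ⊔ g k

  maxBelow-ub : ∀ k g {x} → x < k → g x ≤ maxBelow k g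
  maxBelow-ub (suc k) g {x} x<1+k with m≤n⇒m<n∨m≡n (<⇒≤pred x<1+k)
  ... | inj₁ x<k  = ≤-trans (maxBelow-ub k g x<k) (m≤m⊔n _ _)
  ... | inj₂ refl = m≤n⊔m _ _

  maxBelow-lub : ∀ k g a c → a ≤ c → (∀ {x} → x < k → g x + a ≤ c) → maxBelow k g + a ≤ c
  maxBelow-lub zero    g a c a≤c h = a≤c
  maxBelow-lub (suc k) g a c a≤c h = begin
    (maxBelow k g ⊔ g k) + a      ≡⟨ +-distribʳ-⊔ a (maxBelow k g) (g k) ⟩
    (maxBelow k g + a) ⊔ (g k + a) ≤⟨ ⊔-lub (maxBelow-lub k g a c a≤c (h ∘ m<n⇒m<1+n)) (h ≤-refl) ⟩
    c                             ∎
    where open ≤-Reasoning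

  maxBelow-cong : ∀ k g h → (∀ {x} → x < k → g x ≡ h x) → maxBelow k g ≡ maxBelow k h
  maxBelow-cong zero    g h e = refl
  maxBelow-cong (suc k) g h e = cong₂ _⊔_ (maxBelow-cong k g h (λ x<k → e (m<n⇒m<1+n x<k))) (e ≤-refl)

  -- Index k is "upper" when it is a left-to-right maximum of P and "lower"
  -- otherwise.  We compute levels φ k, strictly increasing in k, such that
  -- for upper k and lower l > k the gap φ l − φ k exceeds Q exactly when
  -- P k < P l.  φ is a longest-path function: φ j is the largest φ x + gap x j
  -- over x < j, plus a step 3^(m ∸ j) whose geometric decrease keeps the
  -- accumulated slack below Q.
  module Placement (m : ℕ) (P : ℕ → ℕ) (Q : ℕ) where

    LRMax : ℕ → Set
    LRMax k = ∀ {x} → x < k → P x < P k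

    lrMax? : ∀ k → Dec (LRMax k)
    lrMax? k = allUpTo? (λ x → P x <? P k) k

    -- Upper x must be placed more than Q levels below lower j.
    Far : ℕ → ℕ → Set
    Far x j = LRMax x × P x < P j × ¬ LRMax j

    far? : ∀ x j → Dec (Far x j)
    far? x j = lrMax? x ×-dec (P x <? P j) ×-dec ¬? (lrMax? j)

    gap : ℕ → ℕ → ℕ
    gap x j with far? x j
    ... | yes _ = suc Q
    ... | no  _ = 0

    gap-far : ∀ {x j} → Far x j → gap x j ≡ suc Q
    gap-far {x} {j} far with far? x j
    ... | yes _    = refl
    ... | no  ¬far = ⊥-elim (¬far far)

    gap-near : ∀ {x j} → ¬ Far x j → gap x j ≡ 0
    gap-near {x} {j} ¬far with far? x j
    ... | yes far = ⊥-elim (¬far far)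
    ... | no  _   = refl

    step : ℕ → ℕ
    step t = 3 ^ (m ∸ t)

    step-pos : ∀ t → 1 ≤ step t
    step-pos t = m^n>0 3 (m ∸ t)

    next : ℕ → (ℕ → ℕ) → ℕ
    next j f = maxBelow j (λ x → f x + gap x j) + step j

    -- table k agrees with φ below k; it makes the course-of-values
    -- recursion defining φ structural.
    table : ℕ → ℕ → ℕ
    table zero    x = 0
    table (suc k) x with x <? k
    ... | yes _ = table k x
    ... | no  _ = next k (table k)

    φ : ℕ → ℕ
    φ x = table (suc x) x

    table-old : ∀ {k x} → x < k → table (suc k) x ≡ table k x
    table-old {k} {x} x<k with x <? k
    ... | yes _   = refl
    ... | no  x≮k = ⊥-elim (x≮k x<k)

    table-new : ∀ k → table (suc k) k ≡ next k (table k)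
    table-new k with k <? k
    ... | yes k<k = ⊥-elim (<-irrefl refl k<k)
    ... | no  _   = refl

    table≡φ : ∀ {k x} → x < k → table k x ≡ φ x
    table≡φ {suc k} x<1+k with m≤n⇒m<n∨m≡n (<⇒≤pred x<1+k)
    ... | inj₁ x<k  = trans (table-old x<k) (table≡φ x<k)
    ... | inj₂ refl = refl

    φ-unfold : ∀ j → φ j ≡ next j φ
    φ-unfold j = trans (table-new j)
      (cong (_+ step j) (maxBelow-cong j _ _ (cong (_+ gap _ j) ∘ table≡φ)))

    φ-above : ∀ {x j} → x < j → φ x + gap x j + step j ≤ φ j
    φ-above {x} {j} x<j = begin
      φ x + gap x j + step j   ≤⟨ +-monoˡ-≤ (step j) (maxBelow-ub j (λ y → φ y + gap y j) x<j) ⟩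
      next j φ                 ≡⟨ sym (φ-unfold j) ⟩
      φ j                      ∎
      where open ≤-Reasoning

    φ-climb : ∀ {x j} → x < j → φ x + step j ≤ φ j
    φ-climb {x} {j} x<j = ≤-trans (+-monoˡ-≤ (step j) (m≤m+n (φ x) (gap x j))) (φ-above x<j)

    φ-strict : ∀ {x j} → x < j → φ x < φ j
    φ-strict {x} {j} x<j = begin-strict
      φ x          <⟨ m<m+n (φ x) (step-pos j) ⟩
      φ x + step j ≤⟨ φ-climb x<j ⟩
      φ j          ∎
      where open ≤-Reasoning

    φ-far : ∀ {x j} → x < j → Far x j → φ x + suc Q ≤ φ j
    φ-far {x} {j} x<j far = begin
      φ x + suc Q             ≤⟨ m≤m+n (φ x + suc Q) (step j) ⟩
      φ x + suc Q + step j    ≡⟨ cong (λ g → φ x + g + step j) (sym (gap-far far)) ⟩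
      φ x + gap x j + step j  ≤⟨ φ-above x<j ⟩
      φ j                     ∎
      where open ≤-Reasoning

    step-shrinks : ∀ {x j} → x < j → j ≤ m → 3 * step j ≤ step x
    step-shrinks {x} {j} x<j j≤m = ^-monoʳ-≤ 3 (∸-monoʳ-< x<j j≤m)

    -- Room for a Far edge plus two steps of j inside the step of any y < j.
    step-room : ∀ {y j} → y < j → j ≤ m → suc (step j + step j) ≤ step y
    step-room {y} {j} y<j j≤m = begin
      suc (step j + step j)      ≤⟨ +-monoˡ-≤ (step j + step j) (step-pos j) ⟩
      step j + (step j + step j) ≡⟨ cong (λ s → step j + (step j + s)) (sym (+-identityʳ (step j))) ⟩
      3 * step j                 ≤⟨ step-shrinks y<j j≤m ⟩
      step y                     ∎
      where open ≤-Reasoning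

    step-bounded : ∀ t → step t ≤ 3 ^ m
    step-bounded t = ^-monoʳ-≤ 3 (m∸n≤m m t)

    lrMax-order : ∀ {x y} → LRMax x → P x < P y → x < y
    lrMax-order {x} {y} max-x Px<Py with <-cmp x y
    ... | tri< x<y _ _ = x<y
    ... | tri≈ _ refl _ = ⊥-elim (<-irrefl refl Px<Py)
    ... | tri> _ _ y<x = ⊥-elim (<-asym Px<Py (max-x y<x))

    Dominates : ℕ → ℕ → Set
    Dominates x j = ∀ {b} → x < b → b ≤ j → ¬ LRMax b → P b < P x

    reshuffle : ∀ a q s → a + suc q + s ≡ a + suc s + q
    reshuffle = solve-∀

    module _ (Q-large : 2 * 3 ^ m ≤ Q) where

      two-steps≤Q : ∀ t → step t + step t ≤ Q
      two-steps≤Q t = begin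
        step t + step t     ≤⟨ +-mono-≤ (step-bounded t) (step-bounded t) ⟩
        3 ^ m + 3 ^ m       ≡⟨ cong (3 ^ m +_) (sym (+-identityʳ (3 ^ m))) ⟩
        2 * 3 ^ m           ≤⟨ Q-large ⟩
        Q                   ∎
        where open ≤-Reasoning

      -- The invariant: if the upper x ≤ j dominates j, then φ j stays
      -- within Q of φ x, with a step of j to spare.
      NearFrom : ℕ → Set
      NearFrom j = j < m → ∀ {x} → x ≤ j → LRMax x → Dominates x j → φ j + step j ≤ φ x + Q

      -- A Far edge x' → j starts left of x (P x' < P j < P x), so it ends
      -- within Q of φ x even after adding two steps of j.
      far-edge : ∀ {x x' j} → j < m → x ≤ j → LRMax x → Dominates x j → Far x' j →
                 φ x' + gap x' j + (step j + step j) ≤ φ x + Q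
      far-edge {x} {x'} {j} j<m x≤j max-x dom far@(max-x' , Px'<Pj , ¬max-j) = begin
        φ x' + gap x' j + (step j + step j)   ≡⟨ cong (λ w → φ x' + w + (step j + step j)) (gap-far far) ⟩
        φ x' + suc Q + (step j + step j)      ≡⟨ reshuffle (φ x') Q (step j + step j) ⟩
        φ x' + suc (step j + step j) + Q      ≤⟨ +-monoˡ-≤ Q (+-monoʳ-≤ (φ x') (step-room x<j (<⇒≤ j<m))) ⟩
        φ x' + step x + Q                     ≤⟨ +-monoˡ-≤ Q (φ-climb x'<x) ⟩
        φ x + Q                               ∎
        where
        open ≤-Reasoning
        x<j : x < j
        x<j = ≤∧≢⇒< x≤j λ { refl → ¬max-j max-x }
        x'<x : x' < x
        x'<x = lrMax-order max-x' (<-trans Px'<Pj (dom x<j ≤-refl ¬max-j))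

      -- Any other edge x' → j has weight 0: for x' < x use φ x' < φ x, and
      -- for x' ≥ x the invariant at x'.
      plain-edge : ∀ {x x' j} → j < m → LRMax x → Dominates x j → x' < j → ¬ Far x' j → NearFrom x' →
                   φ x' + gap x' j + (step j + step j) ≤ φ x + Q
      plain-edge {x} {x'} {j} j<m max-x dom x'<j ¬far near-x' = begin
        φ x' + gap x' j + (step j + step j)   ≡⟨ cong (λ w → φ x' + w + (step j + step j)) (gap-near ¬far) ⟩
        φ x' + 0 + (step j + step j)          ≡⟨ cong (_+ (step j + step j)) (+-identityʳ (φ x')) ⟩
        φ x' + (step j + step j)              ≤⟨ by-position (x' <? x) ⟩
        φ x + Q                               ∎
        where
        open ≤-Reasoning
        by-position : Dec (x' < x) → φ x' + (step j + step j) ≤ φ x + Q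
        by-position (yes x'<x) = +-mono-≤ (<⇒≤ (φ-strict x'<x)) (two-steps≤Q j)
        by-position (no  x'≮x) = begin
          φ x' + (step j + step j)  ≤⟨ +-monoʳ-≤ (φ x') (<⇒≤ (step-room x'<j (<⇒≤ j<m))) ⟩
          φ x' + step x'            ≤⟨ near-x' (<-trans x'<j j<m) (≮⇒≥ x'≮x) max-x
                                         (λ x<b b≤x' → dom x<b (≤-trans b≤x' (<⇒≤ x'<j))) ⟩
          φ x + Q                   ∎

      near-invariant : ∀ j → NearFrom j
      near-invariant = <-rec NearFrom near-step
        where
        near-step : ∀ j → (∀ {x'} → x' < j → NearFrom x') → NearFrom j
        near-step j ih j<m {x} x≤j max-x dom = begin
          φ j + step j                       ≡⟨ cong (_+ step j) (φ-unfold j) ⟩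
          maxBelow j g + step j + step j     ≡⟨ +-assoc (maxBelow j g) (step j) (step j) ⟩
          maxBelow j g + (step j + step j)   ≤⟨ maxBelow-lub j g _ _ (≤-trans (two-steps≤Q j) (m≤n+m Q (φ x))) edge ⟩
          φ x + Q                            ∎
          where
          open ≤-Reasoning
          g : ℕ → ℕ
          g x' = φ x' + gap x' j
          edge : ∀ {x'} → x' < j → g x' + (step j + step j) ≤ φ x + Q
          edge {x'} x'<j = [ far-edge j<m x≤j max-x dom
                           , (λ ¬far → plain-edge j<m max-x dom x'<j ¬far (ih x'<j)) ]′ (toSum (far? x' j))

    module Avoiding321
      (P-injective : ∀ {x y} → x < m → y < m → P x ≡ P y → x ≡ y)
      (P-avoids321 : ∀ {a b c} → a < b → b < c → c < m → P b < P a → P c < P b → ⊥)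
      where

      larger-on-left : ∀ {x} → x < m → ¬ LRMax x → ∃ λ c → c < x × P x < P c
      larger-on-left {x} x<m ¬max with anyUpTo? (λ c → P x <? P c) x
      ... | yes witness = witness
      ... | no  none    = ⊥-elim (¬max smaller)
        where
        smaller : LRMax x
        smaller {c} c<x = ≤∧≢⇒< (≮⇒≥ (λ Px<Pc → none (c , c<x , Px<Pc)))
                                (λ Pc≡Px → <-irrefl (P-injective (<-trans c<x x<m) x<m Pc≡Px) c<x)

      lower-order : ∀ {x y} → x < m → y < m → ¬ LRMax x → ¬ LRMax y → P x < P y → x < y
      lower-order {x} {y} x<m y<m ¬max-x ¬max-y Px<Py with <-cmp x y
      ... | tri< x<y _ _  = x<y
      ... | tri≈ _ refl _ = ⊥-elim (<-irrefl refl Px<Py)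
      ... | tri> _ _ y<x  with larger-on-left y<m ¬max-y
      ...   | c , c<y , Py<Pc = ⊥-elim (P-avoids321 c<y y<x x<m Py<Pc Px<Py)

      lower-increasing : ∀ {x y} → x < m → y < m → ¬ LRMax x → ¬ LRMax y → x < y → P x < P y
      lower-increasing {x} {y} x<m y<m ¬max-x ¬max-y x<y with <-cmp (P x) (P y)
      ... | tri< lt _ _ = lt
      ... | tri≈ _ eq _ = ⊥-elim (<-irrefl (P-injective x<m y<m eq) x<y)
      ... | tri> _ _ gt = ⊥-elim (<-asym x<y (lower-order y<m x<m ¬max-y ¬max-x gt))

      φ-near : 2 * 3 ^ m ≤ Q → ∀ {k l} → LRMax k → ¬ LRMax l → k < l → l < m → P l < P k → φ l < φ k + Q
      φ-near Q-large {k} {l} max-k ¬max-l k<l l<m Pl<Pk =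
        <-≤-trans (m<m+n (φ l) (step-pos l)) (near-invariant Q-large l l<m (<⇒≤ k<l) max-k dom)
        where
        dom : Dominates k l
        dom {b} k<b b≤l ¬max-b with m≤n⇒m<n∨m≡n b≤l
        ... | inj₁ b<l  = <-trans (lower-increasing (<-trans b<l l<m) l<m ¬max-b ¬max-l b<l) Pl<Pk
        ... | inj₂ refl = Pl<Pk

-- Periodicity, and the pattern forced by a large descent.
module Patterns where

  open Levels
  open import Data.Nat as ℕ using (ℕ; zero; suc; _^_; NonZero)
  import Data.Nat.Properties as ℕP
  open import Data.Nat.DivMod using (_/_; _%_; m≡m%n+[m/n]*n; m%n<n; m/n*n≤m; m*n/n≡m; /-monoˡ-≤)
  open import Data.Integer as ℤ using (ℤ; +_; +<+; _+_; _-_; -_; _*_; ∣_∣)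
  import Data.Integer.Properties as ℤP
  import Data.Integer.Tactic.RingSolver as ℤSolver
  import Data.Nat.Tactic.RingSolver as ℕSolver
  open import Data.Fin as Fin using (Fin; toℕ; fromℕ<)
  import Data.Fin.Properties as FinP
  open import Data.Fin.Permutation using (Permutation′; _⟨$⟩ʳ_; _⟨$⟩ˡ_; inverseˡ)
  open import Data.Bool using (if_then_else_)
  open import Function using (_∘_)
  open import Data.Product using (_,_)
  open import Data.Empty using (⊥; ⊥-elim)
  open import Relation.Nullary using (yes; no)
  open import Relation.Nullary.Decidable using (⌊_⌋)
  open import Relation.Binary.PropositionalEquality
  open import Relation.Binary.Definitions using (tri<; tri≈; tri>)

  +-rotate : ∀ a b c → a + (b + c) ≡ a + c + b
  +-rotate = ℤSolver.solve-∀

  cancel-shift : ∀ a b → a + - b + b ≡ a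
  cancel-shift = ℤSolver.solve-∀

  add-sub-shift : ∀ a b → a ≡ a + b + - b
  add-sub-shift = ℤSolver.solve-∀

  displacement-shift : ∀ w z s → (w + s) - (z + s) ≡ w - z
  displacement-shift = ℤSolver.solve-∀

  cancel-left : ∀ a b → a + b - a ≡ b
  cancel-left = ℤSolver.solve-∀

  split-difference : ∀ a b → a ≡ b + (a - b)
  split-difference = ℤSolver.solve-∀

  module Periodic (n : ℕ) (ω : ℤ → ℤ) (periodic : ∀ z → ω (z + + n) ≡ ω z + + n) where

    periodic-ℕ : ∀ k z → ω (z + + (k ℕ.* n)) ≡ ω z + + (k ℕ.* n)
    periodic-ℕ zero    z = trans (cong ω (ℤP.+-identityʳ z)) (sym (ℤP.+-identityʳ (ω z)))
    periodic-ℕ (suc k) z = begin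
      ω (z + + (n ℕ.+ k ℕ.* n))     ≡⟨ cong ω (shift z (+ n) (+ (k ℕ.* n)) (ℤP.pos-+ n (k ℕ.* n))) ⟩
      ω (z + + (k ℕ.* n) + + n)     ≡⟨ periodic _ ⟩
      ω (z + + (k ℕ.* n)) + + n     ≡⟨ cong (_+ + n) (periodic-ℕ k z) ⟩
      ω z + + (k ℕ.* n) + + n       ≡⟨ sym (shift (ω z) (+ n) (+ (k ℕ.* n)) (ℤP.pos-+ n (k ℕ.* n))) ⟩
      ω z + + (n ℕ.+ k ℕ.* n)       ∎
      where
      open ≡-Reasoning
      shift : ∀ a b c {d} → d ≡ b + c → a + d ≡ a + c + b
      shift a b c refl = +-rotate a b c

    periodic-ℤ : ∀ q z → ω (z + q * + n) ≡ ω z + q * + n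
    periodic-ℤ (+ k) z = begin
      ω (z + + k * + n)     ≡⟨ cong (λ s → ω (z + s)) (sym (ℤP.pos-* k n)) ⟩
      ω (z + + (k ℕ.* n))   ≡⟨ periodic-ℕ k z ⟩
      ω z + + (k ℕ.* n)     ≡⟨ cong (λ s → ω z + s) (ℤP.pos-* k n) ⟩
      ω z + + k * + n       ∎
      where open ≡-Reasoning
    periodic-ℤ q@(ℤ.-[1+ k ]) z = begin
      ω (z + q * + n)               ≡⟨ cong (λ s → ω (z + s)) q*n≡-N ⟩
      ω (z + - + N)                 ≡⟨ add-sub-shift (ω (z + - + N)) (+ N) ⟩
      ω (z + - + N) + + N + - + N   ≡⟨ cong (_+ - + N) (sym (periodic-ℕ (suc k) (z + - + N))) ⟩
      ω (z + - + N + + N) + - + N   ≡⟨ cong (λ w → ω w + - + N) (cancel-shift z (+ N)) ⟩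
      ω z + - + N                   ≡⟨ cong (λ s → ω z + s) (sym q*n≡-N) ⟩
      ω z + q * + n                 ∎
      where
      open ≡-Reasoning
      N : ℕ
      N = suc k ℕ.* n
      q*n≡-N : q * + n ≡ - + N
      q*n≡-N = trans (sym (ℤP.neg-distribˡ-* (+ suc k) (+ n))) (cong -_ (sym (ℤP.pos-* (suc k) n)))

    displacement-periodic : ∀ q z → ω (z + q * + n) - (z + q * + n) ≡ ω z - z
    displacement-periodic q z = trans (cong (_- (z + q * + n)) (periodic-ℤ q z)) (displacement-shift (ω z) z (q * + n))

  -- A permutation p ∈ S_m read as a sequence P : ℕ → ℕ (padded by 0 beyond m).
  module AsSequence {m} (p : Permutation′ m) where

    P : ℕ → ℕ
    P k with k ℕP.<? m
    ... | yes k<m = toℕ (p ⟨$⟩ʳ fromℕ< k<m)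
    ... | no  _   = 0

    P-below : ∀ {k} (k<m : k ℕ.< m) → P k ≡ toℕ (p ⟨$⟩ʳ fromℕ< k<m)
    P-below {k} k<m with k ℕP.<? m
    ... | yes _   = refl
    ... | no  k≮m = ⊥-elim (k≮m k<m)

    P-toℕ : ∀ a → P (toℕ a) ≡ toℕ (p ⟨$⟩ʳ a)
    P-toℕ a = trans (P-below (FinP.toℕ<n a)) (cong (λ b → toℕ (p ⟨$⟩ʳ b)) (FinP.fromℕ<-toℕ a (FinP.toℕ<n a)))

    perm-injective : ∀ {a b} → p ⟨$⟩ʳ a ≡ p ⟨$⟩ʳ b → a ≡ b
    perm-injective {a} {b} eq = trans (sym (inverseˡ p)) (trans (cong (p ⟨$⟩ˡ_) eq) (inverseˡ p))

    P-injective : ∀ {x y} → x ℕ.< m → y ℕ.< m → P x ≡ P y → x ≡ y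
    P-injective {x} {y} x<m y<m eq = begin
      x                    ≡⟨ sym (FinP.toℕ-fromℕ< x<m) ⟩
      toℕ (fromℕ< x<m)     ≡⟨ cong toℕ (perm-injective (FinP.toℕ-injective same-value)) ⟩
      toℕ (fromℕ< y<m)     ≡⟨ FinP.toℕ-fromℕ< y<m ⟩
      y                    ∎
      where
      open ≡-Reasoning
      same-value : toℕ (p ⟨$⟩ʳ fromℕ< x<m) ≡ toℕ (p ⟨$⟩ʳ fromℕ< y<m)
      same-value = trans (sym (P-below x<m)) (trans eq (P-below y<m))

    P-avoids321 : Avoids321 p → ∀ {a b c} → a ℕ.< b → b ℕ.< c → c ℕ.< m → P b ℕ.< P a → P c ℕ.< P b → ⊥
    P-avoids321 avoids {a} {b} {c} a<b b<c c<m Pb<Pa Pc<Pb =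
      avoids (fromℕ< a<m , fromℕ< b<m , fromℕ< c<m , fin-< a<m b<m a<b , fin-< b<m c<m b<c ,
              subst₂ ℕ._<_ (P-below b<m) (P-below a<m) Pb<Pa ,
              subst₂ ℕ._<_ (P-below c<m) (P-below b<m) Pc<Pb)
      where
      fin-< : ∀ {x y} (x<m : x ℕ.< m) (y<m : y ℕ.< m) → x ℕ.< y → fromℕ< x<m Fin.< fromℕ< y<m
      fin-< x<m y<m = subst₂ ℕ._<_ (sym (FinP.toℕ-fromℕ< x<m)) (sym (FinP.toℕ-fromℕ< y<m))
      b<m : b ℕ.< m
      b<m = ℕP.<-trans b<c c<m
      a<m : a ℕ.< m
      a<m = ℕP.<-trans a<b b<m

  regroup : ∀ r q u n → r ℕ.+ q ℕ.* n ℕ.+ u ℕ.* n ≡ r ℕ.+ (q ℕ.+ u) ℕ.* n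
  regroup = ℕSolver.solve-∀

  below-next-level : ∀ {n u v r} → u ℕ.< v → r ℕ.< n → r ℕ.+ u ℕ.* n ℕ.< v ℕ.* n
  below-next-level {n} {u} {v} {r} u<v r<n = begin-strict
    r ℕ.+ u ℕ.* n  <⟨ ℕP.+-monoˡ-< (u ℕ.* n) r<n ⟩
    n ℕ.+ u ℕ.* n  ≤⟨ ℕP.*-monoˡ-≤ n u<v ⟩
    v ℕ.* n        ∎
    where open ℕP.≤-Reasoning

  descentBound : ℕ → ℕ → ℕ
  descentBound m n = 2 ℕ.* 3 ^ m ℕ.* n

  -- The pattern is built from translates of the two entries
  -- ω i and ω j (j = i + e): left-to-right maxima of p go to the upper track
  -- i + φ k·n, the remaining entries to the lower track j + φ k·n, with the
  -- levels φ given by the placement above for Q = ⌊δ / n⌋.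
  module LargeDescent {m} (p : Permutation′ m) (avoids : Avoids321 p)
                      (n : ℕ) (ω : ℤ → ℤ) (periodic : ∀ z → ω (z + + n) ≡ ω z + + n) where

    open AsSequence p
    open Periodic n ω periodic

    module Tracks (i : ℤ) (e δ : ℕ) (0<e : 0 ℕ.< e) (e<n : e ℕ.< n)
                  (ω-descent : ω i ≡ ω (i + + e) + + δ) (δ-large : descentBound m n ℕ.≤ δ) where

      instance
        n-nonZero : NonZero n
        n-nonZero = ℕ.>-nonZero (ℕP.<-trans 0<e e<n)

      Q : ℕ
      Q = δ / n

      δ-split : δ ≡ δ % n ℕ.+ Q ℕ.* n
      δ-split = m≡m%n+[m/n]*n δ n

      Q-large : 2 ℕ.* 3 ^ m ℕ.≤ Q
      Q-large = ℕP.≤-trans (ℕP.≤-reflexive (sym (m*n/n≡m (2 ℕ.* 3 ^ m) n))) (/-monoˡ-≤ n δ-large)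

      open Placement m P Q
      open Avoiding321 P-injective (P-avoids321 avoids)

      j : ℤ
      j = i + + e

      offset lift : ℕ → ℕ
      offset k = if ⌊ lrMax? k ⌋ then 0 else e
      lift   k = if ⌊ lrMax? k ⌋ then δ else 0

      position height : ℕ → ℕ
      position k = offset k ℕ.+ φ k ℕ.* n
      height   k = lift k ℕ.+ φ k ℕ.* n

      ω-on-tracks : ∀ k → ω (i + + position k) ≡ ω j + + height k
      ω-on-tracks k with lrMax? k
      ... | yes _ = begin
        ω (i + + (φ k ℕ.* n))             ≡⟨ periodic-ℕ (φ k) i ⟩
        ω i + + (φ k ℕ.* n)               ≡⟨ cong (_+ + (φ k ℕ.* n)) ω-descent ⟩
        ω j + + δ + + (φ k ℕ.* n)         ≡⟨ ℤP.+-assoc (ω j) (+ δ) _ ⟩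
        ω j + (+ δ + + (φ k ℕ.* n))       ≡⟨ cong (λ s → ω j + s) (sym (ℤP.pos-+ δ _)) ⟩
        ω j + + (δ ℕ.+ φ k ℕ.* n)         ∎
        where open ≡-Reasoning
      ... | no _ = begin
        ω (i + + (e ℕ.+ φ k ℕ.* n))       ≡⟨ cong ω (trans (cong (λ s → i + s) (ℤP.pos-+ e _)) (sym (ℤP.+-assoc i (+ e) _))) ⟩
        ω (j + + (φ k ℕ.* n))             ≡⟨ periodic-ℕ (φ k) j ⟩
        ω j + + (φ k ℕ.* n)               ∎
        where open ≡-Reasoning

      position-increasing : ∀ {a b} → a ℕ.< b → position a ℕ.< position b
      position-increasing {a} {b} a<b with lrMax? a | lrMax? b
      ... | yes _ | yes _ = ℕP.*-monoˡ-< n (φ-strict a<b)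
      ... | no  _ | no  _ = ℕP.+-monoʳ-< e (ℕP.*-monoˡ-< n (φ-strict a<b))
      ... | yes _ | no  _ = ℕP.≤-<-trans (ℕP.*-monoˡ-≤ n (ℕP.<⇒≤ (φ-strict a<b))) (ℕP.m<n+m (φ b ℕ.* n) 0<e)
      ... | no  _ | yes _ = below-next-level (φ-strict a<b) e<n

      height-order : ∀ {a b} → a ℕ.< m → b ℕ.< m → P a ℕ.< P b → height a ℕ.< height b
      height-order {a} {b} a<m b<m Pa<Pb with lrMax? a | lrMax? b
      ... | yes max-a | yes _ = ℕP.+-monoʳ-< δ (ℕP.*-monoˡ-< n (φ-strict (lrMax-order max-a Pa<Pb)))
      ... | no ¬max-a | no ¬max-b = ℕP.*-monoˡ-< n (φ-strict (lower-order a<m b<m ¬max-a ¬max-b Pa<Pb))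
      ... | yes max-a | no ¬max-b = begin-strict
        δ ℕ.+ φ a ℕ.* n                   ≡⟨ cong (ℕ._+ φ a ℕ.* n) δ-split ⟩
        δ % n ℕ.+ Q ℕ.* n ℕ.+ φ a ℕ.* n   ≡⟨ regroup (δ % n) Q (φ a) n ⟩
        δ % n ℕ.+ (Q ℕ.+ φ a) ℕ.* n       <⟨ below-next-level Q+φa<φb (m%n<n δ n) ⟩
        φ b ℕ.* n                         ∎
        where
        open ℕP.≤-Reasoning
        Q+φa<φb : Q ℕ.+ φ a ℕ.< φ b
        Q+φa<φb = ℕP.<-≤-trans (ℕP.≤-reflexive (ℕP.+-comm (suc Q) (φ a)))
                    (φ-far (lrMax-order max-a Pa<Pb) (max-a , Pa<Pb , ¬max-b))
      ... | no ¬max-a | yes max-b with ℕP.<-cmp a b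
      ...   | tri< a<b _ _  = ℕP.<-≤-trans (ℕP.*-monoˡ-< n (φ-strict a<b)) (ℕP.m≤n+m (φ b ℕ.* n) δ)
      ...   | tri≈ _ refl _ = ⊥-elim (ℕP.<-irrefl refl Pa<Pb)
      ...   | tri> _ _ b<a  = begin-strict
        φ a ℕ.* n                         <⟨ below-next-level (φ-near Q-large max-b ¬max-a b<a a<m Pa<Pb) (ℕP.<-trans 0<e e<n) ⟩
        (φ b ℕ.+ Q) ℕ.* n                 ≡⟨ ℕP.*-distribʳ-+ n (φ b) Q ⟩
        φ b ℕ.* n ℕ.+ Q ℕ.* n             ≤⟨ ℕP.+-monoʳ-≤ (φ b ℕ.* n) (m/n*n≤m δ n) ⟩
        φ b ℕ.* n ℕ.+ δ                   ≡⟨ ℕP.+-comm (φ b ℕ.* n) δ ⟩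
        δ ℕ.+ φ b ℕ.* n                   ∎
        where open ℕP.≤-Reasoning

      contains : AffContains ω p
      contains = index , index-increasing , λ a b → forward a b , backward a b
        where
        index : Fin m → ℤ
        index a = i + + position (toℕ a)

        index-increasing : ∀ a b → a Fin.< b → index a ℤ.< index b
        index-increasing a b a<b = ℤP.+-monoʳ-< i (+<+ (position-increasing a<b))

        forward : ∀ a b → (p ⟨$⟩ʳ a) Fin.< (p ⟨$⟩ʳ b) → ω (index a) ℤ.< ω (index b)
        forward a b pa<pb =
          subst₂ ℤ._<_ (sym (ω-on-tracks (toℕ a))) (sym (ω-on-tracks (toℕ b)))
            (ℤP.+-monoʳ-< (ω j) (+<+ (height-order (FinP.toℕ<n a) (FinP.toℕ<n b)
              (subst₂ ℕ._<_ (sym (P-toℕ a)) (sym (P-toℕ b)) pa<pb))))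

        backward : ∀ a b → ω (index a) ℤ.< ω (index b) → (p ⟨$⟩ʳ a) Fin.< (p ⟨$⟩ʳ b)
        backward a b ωa<ωb with ℕP.<-cmp (toℕ (p ⟨$⟩ʳ a)) (toℕ (p ⟨$⟩ʳ b))
        ... | tri< pa<pb _ _ = pa<pb
        ... | tri≈ _ pa≡pb _ = ⊥-elim (ℤP.<-irrefl (cong (ω ∘ index) (perm-injective (FinP.toℕ-injective pa≡pb))) ωa<ωb)
        ... | tri> _ _ pb<pa = ⊥-elim (ℤP.<-asym ωa<ωb (forward b a pb<pa))

    large-descent-contains : ∀ i e → 0 ℕ.< e → e ℕ.< n →
                             ω (i + + e) + + (descentBound m n) ℤ.≤ ω i → AffContains ω p
    large-descent-contains i e 0<e e<n descent =
      Tracks.contains i e ∣ gap ∣ 0<e e<n ω-descent (ℤP.drop‿+≤+ (subst (+ (descentBound m n) ℤ.≤_) (sym ∣gap∣≡gap) Δ≤gap))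
      where
      gap : ℤ
      gap = ω i - ω (i + + e)
      Δ≤gap : + descentBound m n ℤ.≤ gap
      Δ≤gap = subst₂ ℤ._≤_ (cancel-left (ω (i + + e)) (+ (descentBound m n))) refl
                (ℤP.+-monoˡ-≤ (- ω (i + + e)) descent)
      ∣gap∣≡gap : + ∣ gap ∣ ≡ gap
      ∣gap∣≡gap = ℤP.0≤i⇒+∣i∣≡i (ℤP.≤-trans (ℤ.+≤+ ℕ.z≤n) Δ≤gap)
      ω-descent : ω i ≡ ω (i + + e) + + ∣ gap ∣
      ω-descent = trans (split-difference (ω i) (ω (i + + e))) (cong (λ s → ω (i + + e) + s) (sym ∣gap∣≡gap))

    no-large-descent : AffAvoids ω p → ∀ i e → 0 ℕ.< e → e ℕ.< n → ω i ℤ.< ω (i + + e) + + (descentBound m n)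
    no-large-descent avoid i e 0<e e<n = ℤP.≰⇒> (avoid ∘ large-descent-contains i e 0<e e<n)

-- Bounded displacement of the p-avoiding elements of S̃_n.
module Displacement where

  open Patterns
  open import Data.Nat as ℕ using (ℕ; zero; suc; NonZero)
  import Data.Nat.Properties as ℕP
  open import Data.Nat.Combinatorics using (_C_; nCk+nC[k+1]≡[n+1]C[k+1]; nC1≡n)
  open import Data.Integer as ℤ using (ℤ; +_; +<+; +≤+; _+_; _-_; -_; _*_; _%ℕ_; _/ℕ_)
  import Data.Integer.Properties as ℤP
  open import Data.Integer.DivMod using (a≡a%ℕn+[a/ℕn]*n; n%ℕd<d)
  import Data.Integer.Tactic.RingSolver as ℤSolver
  open import Data.Fin.Permutation using (Permutation′)
  open import Data.Product using (∃; _×_; _,_)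
  open import Data.Sum using (_⊎_; inj₁; inj₂)
  open import Data.Empty using (⊥-elim)
  open import Relation.Nullary using (¬_; yes; no)
  open import Relation.Binary.PropositionalEquality

  step-regroup : ∀ a b k → a + b + (+ 1 + k) ≡ (a + k) + (+ 1 + b)
  step-regroup = ℤSolver.solve-∀

  compare-windowSums : ∀ f g k → (∃ λ s → f s ℤ.≤ g s) ⊎ (windowSum g k + + k ℤ.≤ windowSum f k)
  compare-windowSums f g zero = inj₂ ℤP.≤-refl
  compare-windowSums f g (suc k) with compare-windowSums f g k
  ... | inj₁ found = inj₁ found
  ... | inj₂ excess with f (+ suc k) ℤP.≤? g (+ suc k)
  ...   | yes f≤g = inj₁ (+ suc k , f≤g)
  ...   | no  f≰g = inj₂ (begin
    windowSum g k + g (+ suc k) + + suc k          ≡⟨ cong (λ s → windowSum g k + g (+ suc k) + s) (ℤP.pos-+ 1 k) ⟩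
    windowSum g k + g (+ suc k) + (+ 1 + + k)      ≡⟨ step-regroup (windowSum g k) (g (+ suc k)) (+ k) ⟩
    (windowSum g k + + k) + (+ 1 + g (+ suc k))    ≤⟨ ℤP.+-mono-≤ excess (ℤP.i<j⇒suc[i]≤j (ℤP.≰⇒> f≰g)) ⟩
    windowSum f k + f (+ suc k)                    ∎)
    where open ℤP.≤-Reasoning

  windowSum-id : ∀ k → windowSum (λ z → z) k ≡ + (suc k C 2)
  windowSum-id zero    = refl
  windowSum-id (suc k) = begin
    windowSum (λ z → z) k + + suc k     ≡⟨ cong (_+ + suc k) (windowSum-id k) ⟩
    + (suc k C 2) + + suc k             ≡⟨ sym (ℤP.pos-+ (suc k C 2) (suc k)) ⟩
    + (suc k C 2 ℕ.+ suc k)             ≡⟨ cong +_ (ℕP.+-comm (suc k C 2) (suc k)) ⟩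
    + (suc k ℕ.+ suc k C 2)             ≡⟨ cong (λ c → + (c ℕ.+ suc k C 2)) (sym (nC1≡n (suc k))) ⟩
    + (suc k C 1 ℕ.+ suc k C 2)         ≡⟨ cong +_ (nCk+nC[k+1]≡[n+1]C[k+1] (suc k) 1) ⟩
    + (suc (suc k) C 2)                 ∎
    where open ≡-Reasoning

  realign : ∀ t s R q N → s - t ≡ R + q * N → t + R ≡ s + - q * N
  realign t s R q N eq = begin
    t + R                   ≡⟨ add-sub-product t R q N ⟩
    t + (R + q * N) - q * N ≡⟨ cong (λ d → t + d - q * N) (sym eq) ⟩
    t + (s - t) - q * N     ≡⟨ collapse t s q N ⟩
    s + - q * N             ∎
    where
    open ≡-Reasoning
    add-sub-product : ∀ t R q N → t + R ≡ t + (R + q * N) - q * N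
    add-sub-product = ℤSolver.solve-∀
    collapse : ∀ t s q N → t + (s - t) - q * N ≡ s + - q * N
    collapse = ℤSolver.solve-∀

  excess-contradiction : ∀ a {k} → 0 ℕ.< k → ¬ (a + + k ℤ.≤ a)
  excess-contradiction a 0<k a+k≤a =
    ℤP.<⇒≱ (subst (ℤ._< a + + _) (ℤP.+-identityʳ a) (ℤP.+-monoʳ-< a (+<+ 0<k))) a+k≤a

  upper-from : ∀ {x y c} → y ℤ.≤ x + c → y - x ℤ.≤ c
  upper-from {x} {y} {c} y≤x+c = subst (y - x ℤ.≤_) (cancel-left x c) (ℤP.+-monoˡ-≤ (- x) y≤x+c)

  lower-from : ∀ {x y c} → x ℤ.≤ y + c → - c ℤ.≤ y - x
  lower-from {x} {y} {c} x≤y+c =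
    subst₂ ℤ._≤_ (left x c) (right x y c) (ℤP.+-monoˡ-≤ (- x - c) x≤y+c)
    where
    left : ∀ x c → x + (- x - c) ≡ - c
    left = ℤSolver.solve-∀
    right : ∀ x y c → y + c + (- x - c) ≡ y - x
    right = ℤSolver.solve-∀

  displacementBound : ℕ → ℕ → ℕ
  displacementBound m n = descentBound m n ℕ.+ n

  -- Because its window sum vanishes, the displacement is
  -- ≤ 0 somewhere and ≥ 0 somewhere; by periodicity these values recur in
  -- every window of length n, and the absence of large descents transfers
  -- them to every point with an error below K.
  module DisplacementBound {m} (p : Permutation′ m) (avoids : Avoids321 p)
                           (n : ℕ) (1≤n : 1 ℕ.≤ n) (ω : ℤ → ℤ)
                           (aff : IsAffinePerm n ω) (avoid : AffAvoids ω p) where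

    open IsAffinePerm aff
    open Periodic n ω periodic
    open LargeDescent p avoids n ω periodic using (no-large-descent)

    instance
      n-nonZero : NonZero n
      n-nonZero = ℕ.>-nonZero 1≤n

    D : ℤ → ℤ
    D z = ω z - z

    Δ K : ℕ
    Δ = descentBound m n
    K = displacementBound m n

    recurs-in-window : ∀ t s → ∃ λ r → r ℕ.< n × D (t + + r) ≡ D s
    recurs-in-window t s = r , n%ℕd<d (s - t) n , (begin
      D (t + + r)              ≡⟨ cong D (realign t s (+ r) q (+ n) (a≡a%ℕn+[a/ℕn]*n (s - t) n)) ⟩
      D (s + - q * + n)        ≡⟨ displacement-periodic (- q) s ⟩
      D s                      ∎)
      where
      open ≡-Reasoning
      r : ℕ
      r = (s - t) %ℕ n
      q : ℤ
      q = (s - t) /ℕ n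

    sums-agree : windowSum ω n ≡ windowSum (λ z → z) n
    sums-agree = trans sumWindow (sym (windowSum-id n))

    -- The window sum of D vanishes, so D changes sign (weakly) somewhere.
    somewhere-nonpositive : ∃ λ s → D s ℤ.≤ + 0
    somewhere-nonpositive with compare-windowSums ω (λ z → z) n
    ... | inj₁ (s , ωs≤s) = s , ℤP.i≤j⇒i-j≤0 ωs≤s
    ... | inj₂ excess     = ⊥-elim (excess-contradiction (windowSum (λ z → z) n) 1≤n
            (subst (windowSum (λ z → z) n + + n ℤ.≤_) sums-agree excess))

    somewhere-nonnegative : ∃ λ s → + 0 ℤ.≤ D s
    somewhere-nonnegative with compare-windowSums (λ z → z) ω n
    ... | inj₁ (s , s≤ωs) = s , ℤP.i≤j⇒0≤j-i s≤ωs
    ... | inj₂ excess     = ⊥-elim (excess-contradiction (windowSum (λ z → z) n) 1≤n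
            (subst (λ a → a + + n ℤ.≤ windowSum (λ z → z) n) sums-agree excess))

    -- Move a point with D ≤ 0 into the window [t, t + n) and compare with t.
    displacement-upper : ∀ t → D t ℤ.≤ + K
    displacement-upper t with somewhere-nonpositive
    ... | s , Ds≤0 with recurs-in-window t s
    ...   | zero , _ , Dt≡Ds = ℤP.≤-trans (ℤP.≤-reflexive (trans (cong D (sym (ℤP.+-identityʳ t))) Dt≡Ds))
                                          (ℤP.≤-trans Ds≤0 (+≤+ ℕ.z≤n))
    ...   | r@(suc _) , r<n , Dtr≡Ds = upper-from {t} {ω t} (begin
      ω t                ≤⟨ ℤP.<⇒≤ (no-large-descent avoid t r (ℕ.s≤s ℕ.z≤n) r<n) ⟩
      ω (t + + r) + + Δ  ≤⟨ ℤP.+-monoˡ-≤ (+ Δ) ωtr≤tr ⟩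
      t + + r + + Δ      ≡⟨ ℤP.+-assoc t (+ r) (+ Δ) ⟩
      t + (+ r + + Δ)    ≡⟨ cong (λ d → t + d) (sym (ℤP.pos-+ r Δ)) ⟩
      t + + (r ℕ.+ Δ)    ≤⟨ ℤP.+-monoʳ-≤ t (+≤+ r+Δ≤K) ⟩
      t + + K            ∎)
      where
      open ℤP.≤-Reasoning
      ωtr≤tr : ω (t + + r) ℤ.≤ t + + r
      ωtr≤tr = ℤP.i-j≤0⇒i≤j (subst (ℤ._≤ + 0) (sym Dtr≡Ds) Ds≤0)
      r+Δ≤K : r ℕ.+ Δ ℕ.≤ K
      r+Δ≤K = ℕP.≤-trans (ℕP.+-monoˡ-≤ Δ (ℕP.<⇒≤ r<n)) (ℕP.≤-reflexive (ℕP.+-comm n Δ))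

    -- Move a point with D ≥ 0 into [t, t + n), then back by n, and compare.
    displacement-lower : ∀ t → - + K ℤ.≤ D t
    displacement-lower t with somewhere-nonnegative
    ... | s , 0≤Ds with recurs-in-window t s
    ...   | zero , _ , Dt≡Ds = ℤP.≤-trans (ℤP.neg-≤-pos {K} {0})
                                 (subst (+ 0 ℤ.≤_) (trans (sym Dt≡Ds) (cong D (ℤP.+-identityʳ t))) 0≤Ds)
    ...   | r@(suc _) , r<n , Dtr≡Ds = lower-from {t} {ω t} (begin
      t                        ≤⟨ ℤP.i≤i+j t (+ r) ⟩
      t + + r                  ≤⟨ ℤP.0≤i-j⇒j≤i (subst (+ 0 ℤ.≤_) (sym Dtr≡Ds) 0≤Ds) ⟩
      ω (t + + r)              ≡⟨ cong ω (sym a+n≡t+r) ⟩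
      ω (a + + n)              ≡⟨ periodic a ⟩
      ω a + + n                <⟨ ℤP.+-monoˡ-< (+ n) (no-large-descent avoid a e 0<e e<n) ⟩
      ω (a + + e) + + Δ + + n  ≡⟨ cong (λ z → ω z + + Δ + + n) (cancel-shift t (+ e)) ⟩
      ω t + + Δ + + n          ≡⟨ ℤP.+-assoc (ω t) (+ Δ) (+ n) ⟩
      ω t + (+ Δ + + n)        ≡⟨ cong (λ d → ω t + d) (sym (ℤP.pos-+ Δ n)) ⟩
      ω t + + K                ∎)
      where
      open ℤP.≤-Reasoning
      e : ℕ
      e = n ℕ.∸ r
      0<e : 0 ℕ.< e
      0<e = ℕP.m<n⇒0<n∸m r<n
      e<n : e ℕ.< n
      e<n = ℕP.∸-monoʳ-< (ℕ.s≤s ℕ.z≤n) (ℕP.<⇒≤ r<n)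
      a : ℤ
      a = t - + e
      a+n≡t+r : a + + n ≡ t + + r
      a+n≡t+r = begin-equality
        t - + e + + n            ≡⟨ cong (λ k → t - + e + + k) (sym (ℕP.m+[n∸m]≡n (ℕP.<⇒≤ r<n))) ⟩
        t - + e + + (r ℕ.+ e)    ≡⟨ cong (λ d → t - + e + d) (ℤP.pos-+ r e) ⟩
        t - + e + (+ r + + e)    ≡⟨ swap-shift t (+ e) (+ r) ⟩
        t + + r                  ∎
        where
        swap-shift : ∀ t e r → t - e + (r + e) ≡ t + r
        swap-shift = ℤSolver.solve-∀

-- The p-avoiding elements of S̃_n lie in an explicit finite list.
module Finiteness where

  open Patterns
  open Displacement
  open import Data.Nat as ℕ using (ℕ; zero; suc; z<s; s<s; NonZero)
  open import Data.Integer as ℤ using (ℤ; +_; _+_; _-_; -_; _*_; ∣_∣; _%ℕ_; _/ℕ_)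
  import Data.Integer.Properties as ℤP
  open import Data.Integer.DivMod using (a≡a%ℕn+[a/ℕn]*n; n%ℕd<d)
  import Data.Integer.Tactic.RingSolver as ℤSolver
  open import Data.Fin.Permutation using (Permutation′)
  open import Data.List using (List; []; _∷_; map; upTo; cartesianProductWith)
  open import Data.List.Relation.Unary.Any as Any using (Any; here)
  import Data.List.Relation.Unary.Any.Properties as AnyP
  open import Data.List.Membership.Propositional.Properties using (∈-upTo⁺)
  open import Relation.Binary.PropositionalEquality
  open import Data.Product using (_,_)

  split-displacement : ∀ w z → w ≡ z + (w - z)
  split-displacement = ℤSolver.solve-∀

  shift-back : ∀ d k → d ≡ d + k - k
  shift-back = ℤSolver.solve-∀

  _◃_ : ℕ → (ℕ → ℕ) → ℕ → ℕ
  (v ◃ f) zero    = v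
  (v ◃ f) (suc r) = f r

  -- All tables [0, k) → [0, B), each padded to a function ℕ → ℕ.
  tables : ℕ → ℕ → List (ℕ → ℕ)
  tables B zero    = (λ _ → 0) ∷ []
  tables B (suc k) = cartesianProductWith _◃_ (upTo B) (tables B k)

  tables-complete : ∀ B k (g : ℕ → ℕ) → (∀ {r} → r ℕ.< k → g r ℕ.< B) →
                    Any (λ f → ∀ {r} → r ℕ.< k → f r ≡ g r) (tables B k)
  tables-complete B zero    g bounded = here (λ ())
  tables-complete B (suc k) g bounded =
    AnyP.cartesianProductWith⁺ _◃_ prepend (∈-upTo⁺ (bounded z<s))
      (tables-complete B k (λ r → g (suc r)) (λ r<k → bounded (s<s r<k)))
    where
    prepend : ∀ {v f} → g 0 ≡ v → (∀ {r} → r ℕ.< k → f r ≡ g (suc r)) →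
              ∀ {r} → r ℕ.< suc k → (v ◃ f) r ≡ g r
    prepend refl agree {zero}  _           = refl
    prepend refl agree {suc r} (s<s r<k)   = agree r<k

  -- For 321-avoiding p, the p-avoiding elements of S̃_n are among finitely
  -- many candidates: ω z = z + D z with D n-periodic and |D| ≤ K, so ω is
  -- determined by the table r ↦ D r + K on [0, n), which takes values in [0, 2K].
  module FiniteAvoiders {m} (p : Permutation′ m) (avoids : Avoids321 p) (n : ℕ) (1≤n : 1 ℕ.≤ n) where

    instance
      n-nonZero : NonZero n
      n-nonZero = ℕ.>-nonZero 1≤n

    K : ℕ
    K = displacementBound m n

    candidate : (ℕ → ℕ) → ℤ → ℤ
    candidate f z = z + (+ f (z %ℕ n) - + K)

    candidates : List (ℤ → ℤ)
    candidates = map candidate (tables (suc (K ℕ.+ K)) n)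

    covered : ∀ ω → IsAffinePerm n ω → AffAvoids ω p → Any (λ f → ∀ i → ω i ≡ f i) candidates
    covered ω aff avoid =
      AnyP.map⁺ (Any.map agrees (tables-complete (suc (K ℕ.+ K)) n code code-bounded))
      where
      open IsAffinePerm aff
      open Periodic n ω periodic using (displacement-periodic)
      open DisplacementBound p avoids n 1≤n ω aff avoid using (D; displacement-upper; displacement-lower)

      code : ℕ → ℕ
      code r = ∣ D (+ r) + + K ∣

      code≡ : ∀ r → + code r ≡ D (+ r) + + K
      code≡ r = ℤP.0≤i⇒+∣i∣≡i (subst (ℤ._≤ D (+ r) + + K) (ℤP.+-inverseˡ (+ K)) (ℤP.+-monoˡ-≤ (+ K) (displacement-lower (+ r))))

      code-bounded : ∀ {r} → r ℕ.< n → code r ℕ.< suc (K ℕ.+ K)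
      code-bounded {r} _ = ℕ.s≤s (ℤP.drop‿+≤+ (subst₂ ℤ._≤_ (sym (code≡ r)) (sym (ℤP.pos-+ K K))
                                    (ℤP.+-monoˡ-≤ (+ K) (displacement-upper (+ r)))))

      agrees : ∀ {f} → (∀ {r} → r ℕ.< n → f r ≡ code r) → ∀ z → ω z ≡ candidate f z
      agrees {f} table z = begin
        ω z                         ≡⟨ split-displacement (ω z) z ⟩
        z + D z                     ≡⟨ cong (λ w → z + D w) (a≡a%ℕn+[a/ℕn]*n z n) ⟩
        z + D (+ r + q * + n)       ≡⟨ cong (λ d → z + d) (displacement-periodic q (+ r)) ⟩
        z + D (+ r)                 ≡⟨ cong (λ d → z + d) (shift-back (D (+ r)) (+ K)) ⟩
        z + (D (+ r) + + K - + K)   ≡⟨ cong (λ c → z + (c - + K)) (sym (trans (cong +_ (table (n%ℕd<d z n))) (code≡ r))) ⟩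
        candidate f z               ∎
        where
        open ≡-Reasoning
        r : ℕ
        r = z %ℕ n
        q : ℤ
        q = z /ℕ n

  finitely-many-avoiders : ∀ {m} (p : Permutation′ m) → Avoids321 p → ∀ n → 1 ℕ.≤ n → FinitelyManyAvoiders n p
  finitely-many-avoiders p avoids n 1≤n = candidates , covered
    where open FiniteAvoiders p avoids n 1≤n

-- Infinitely many elements of S̃_2 avoid any p containing 321.
module Infinitude where

  open import Data.Nat as ℕ using (ℕ; zero; suc)
  import Data.Nat.Properties as ℕP
  open import Data.Integer as ℤ using (ℤ; +_; -[1+_]; _+_; _-_; -_; ∣_∣)
  import Data.Integer.Properties as ℤP
  import Data.Integer.Tactic.RingSolver as ℤSolver
  open import Data.Bool using (Bool; true; false; not)
  open import Data.Fin.Permutation using (Permutation′)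
  open import Data.List using (List; []; _∷_)
  open import Data.List.Relation.Unary.Any using (Any; here; there)
  open import Data.Product using (_,_; proj₁)
  open import Data.Sum using (_⊎_; inj₁; inj₂)
  open import Relation.Nullary using (¬_)
  open import Relation.Binary.PropositionalEquality

  evenℕ : ℕ → Bool
  evenℕ zero          = true
  evenℕ (suc zero)    = false
  evenℕ (suc (suc k)) = evenℕ k

  isEven : ℤ → Bool
  isEven (+ k)     = evenℕ k
  isEven -[1+ k ]  = evenℕ (suc k)

  isEven-+2 : ∀ z → isEven (z + + 2) ≡ isEven z
  isEven-+2 (+ k) = cong evenℕ (ℕP.+-comm k 2)
  isEven-+2 -[1+ zero ]        = refl
  isEven-+2 -[1+ suc zero ]    = refl
  isEven-+2 -[1+ suc (suc k) ] = refl

  +2-shift : ∀ z x → z + (x + + 2) ≡ z + x + + 2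
  +2-shift = ℤSolver.solve-∀

  isEven-+even : ∀ c z → isEven (z + + (2 ℕ.* c)) ≡ isEven z
  isEven-+even zero    z = cong isEven (ℤP.+-identityʳ z)
  isEven-+even (suc c) z = begin
    isEven (z + + (2 ℕ.* suc c))        ≡⟨ cong (λ k → isEven (z + + k)) (trans (ℕP.*-suc 2 c) (ℕP.+-comm 2 (2 ℕ.* c))) ⟩
    isEven (z + + (2 ℕ.* c ℕ.+ 2))      ≡⟨ cong (λ x → isEven (z + x)) (ℤP.pos-+ (2 ℕ.* c) 2) ⟩
    isEven (z + (+ (2 ℕ.* c) + + 2))    ≡⟨ cong isEven (+2-shift z (+ (2 ℕ.* c))) ⟩
    isEven (z + + (2 ℕ.* c) + + 2)      ≡⟨ isEven-+2 (z + + (2 ℕ.* c)) ⟩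
    isEven (z + + (2 ℕ.* c))            ≡⟨ isEven-+even c z ⟩
    isEven z                            ∎
    where open ≡-Reasoning

  undo-shift : ∀ z x → z - x + x ≡ z
  undo-shift = ℤSolver.solve-∀

  isEven--even : ∀ c z → isEven (z - + (2 ℕ.* c)) ≡ isEven z
  isEven--even c z = trans (sym (isEven-+even c (z - + (2 ℕ.* c)))) (cong isEven (undo-shift z (+ (2 ℕ.* c))))

  two-agree : ∀ (a b c : Bool) → a ≡ b ⊎ b ≡ c ⊎ a ≡ c
  two-agree false false _     = inj₁ refl
  two-agree true  true  _     = inj₁ refl
  two-agree false true  true  = inj₂ (inj₁ refl)
  two-agree true  false false = inj₂ (inj₁ refl)
  two-agree false true  false = inj₂ (inj₂ refl)
  two-agree true  false true  = inj₂ (inj₂ refl)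

  -- It is increasing on each parity class, hence a union of two increasing
  -- sequences, so it avoids every pattern containing 321.
  module ParityShift (c : ℕ) where

    shift : Bool → ℤ
    shift true  = - + (2 ℕ.* c)
    shift false = + (2 ℕ.* c)

    ω : ℤ → ℤ
    ω z = z + shift (isEven z)

    ω⁻¹ : ℤ → ℤ
    ω⁻¹ z = z + shift (not (isEven z))

    isEven-shift : ∀ b z → isEven (z + shift b) ≡ isEven z
    isEven-shift true  z = isEven--even c z
    isEven-shift false z = isEven-+even c z

    shift-cancels : ∀ b z → z + shift b + shift (not b) ≡ z
    shift-cancels true  z = undo-shift z (+ (2 ℕ.* c))
    shift-cancels false z = cancel z (+ (2 ℕ.* c))
      where
      cancel : ∀ z x → z + x + - x ≡ z
      cancel = ℤSolver.solve-∀

    ω⁻¹-ω : ∀ z → ω⁻¹ (ω z) ≡ z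
    ω⁻¹-ω z = trans (cong (λ b → ω z + shift (not b)) (isEven-shift (isEven z) z)) (shift-cancels (isEven z) z)

    ω-ω⁻¹ : ∀ z → ω (ω⁻¹ z) ≡ z
    ω-ω⁻¹ z = trans (cong (λ b → ω⁻¹ z + shift b) (isEven-shift (not (isEven z)) z))
                    (subst (λ b → z + shift (not (isEven z)) + shift b ≡ z) (not-involutive (isEven z))
                           (shift-cancels (not (isEven z)) z))
      where
      not-involutive : ∀ b → not (not b) ≡ b
      not-involutive true  = refl
      not-involutive false = refl

    affine : IsAffinePerm 2 ω
    affine = record
      { bijective = (λ {x} {y} ωx≡ωy → trans (sym (ω⁻¹-ω x)) (trans (cong ω⁻¹ ωx≡ωy) (ω⁻¹-ω y)))
                  , (λ y → ω⁻¹ y , λ {z} z≡ → trans (cong ω z≡) (ω-ω⁻¹ y))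
      ; periodic  = λ z → trans (cong (λ b → z + + 2 + shift b) (isEven-+2 z)) (swap z (shift (isEven z)))
      ; sumWindow = window (+ (2 ℕ.* c))
      }
      where
      swap : ∀ z s → z + + 2 + s ≡ z + s + + 2
      swap = ℤSolver.solve-∀
      window : ∀ x → + 0 + (+ 1 + x) + (+ 2 + - x) ≡ + 3
      window = ℤSolver.solve-∀

    increasing-on-parity-class : ∀ {x y} → isEven x ≡ isEven y → x ℤ.< y → ω x ℤ.< ω y
    increasing-on-parity-class {x} {y} same x<y =
      subst (λ b → ω x ℤ.< y + shift b) same (ℤP.+-monoˡ-< (shift (isEven x)) x<y)

    avoids-321-patterns : ∀ {m} (p : Permutation′ m) → Contains321 p → AffAvoids ω p
    avoids-321-patterns p (a , b , c , a<b , b<c , pb<pa , pc<pb) (index , increasing , order)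
      with two-agree (isEven (index a)) (isEven (index b)) (isEven (index c))
    ... | inj₁ ab = ℤP.<-asym (increasing-on-parity-class ab (increasing a b a<b)) (proj₁ (order b a) pb<pa)
    ... | inj₂ (inj₁ bc) = ℤP.<-asym (increasing-on-parity-class bc (increasing b c b<c)) (proj₁ (order c b) pc<pb)
    ... | inj₂ (inj₂ ac) = ℤP.<-asym (increasing-on-parity-class ac (ℤP.<-trans (increasing a b a<b) (increasing b c b<c)))
                                      (ℤP.<-trans (proj₁ (order c b) pc<pb) (proj₁ (order b a) pb<pa))

  boundAt1 : List (ℤ → ℤ) → ℕ
  boundAt1 []       = 0
  boundAt1 (f ∷ fs) = ∣ f (+ 1) ∣ ℕ.+ boundAt1 fs

  boundAt1-sound : ∀ (g : ℤ → ℤ) L → Any (λ f → ∀ i → g i ≡ f i) L → ∣ g (+ 1) ∣ ℕ.≤ boundAt1 L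
  boundAt1-sound g (f ∷ fs) (here g≗f)  = ℕP.≤-trans (ℕP.≤-reflexive (cong ∣_∣ (g≗f (+ 1)))) (ℕP.m≤m+n _ _)
  boundAt1-sound g (f ∷ fs) (there any) = ℕP.≤-trans (boundAt1-sound g fs any) (ℕP.m≤n+m _ _)

  -- If p contains 321 then infinitely many elements of S̃_2 avoid p: a finite
  -- list cannot contain ParityShift c for c = boundAt1 L, since that map sends
  -- 1 to 1 + 2c.
  not-finitely-many : ∀ {m} (p : Permutation′ m) → Contains321 p → ¬ FinitelyManyAvoiders 2 p
  not-finitely-many p contains321 (L , covers) =
    ℕP.<-irrefl refl (ℕP.<-≤-trans (ℕ.s≤s (ℕP.m≤m+n c (c ℕ.+ 0)))
      (boundAt1-sound ω L (covers ω affine (avoids-321-patterns p contains321))))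
    where
    c : ℕ
    c = boundAt1 L
    open ParityShift c

-- Theorem 1.1.
theorem1p1 : (m : ℕ) → 1 ≤ m → (p : Permutation′ m) →
    ((n : ℕ) → 2 ≤ n → FinitelyManyAvoiders n p) ⇔ Avoids321 p
theorem1p1 m _ p = mk⇔ finite⇒avoids321 avoids321⇒finite
  where
  open Finiteness using (finitely-many-avoiders)
  open Infinitude using (not-finitely-many)

  finite⇒avoids321 : ((n : ℕ) → 2 ≤ n → FinitelyManyAvoiders n p) → Avoids321 p
  finite⇒avoids321 finite contains321 = not-finitely-many p contains321 (finite 2 ≤-refl)

  avoids321⇒finite : Avoids321 p → (n : ℕ) → 2 ≤ n → FinitelyManyAvoiders n p
  avoids321⇒finite avoids n 2≤n = finitely-many-avoiders p avoids n (≤-trans (s≤s z≤n) 2≤n)
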